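{- Let $B=\langle f,\mathrm{supp}(Y),M_0\rangle$ be a Boolean network and $N=\langle g_i,Y,\mathbf 1_{y_i}\rangle$ a local multi-valued network such that $B\sim_\psi N$. Then for every mode $M\subseteq 2^{\mathrm{supp}(Y)}$ with $\mathrm{adm}_\psi(M,M_0)$, the Boolean network $B'=\langle f,\mathrm{supp}(Y),M\rangle$ satisfies $B'\sim_\psi N$.
   Context: $Y$ is a finite set of integer variables, $y_i\in Y$ taking values in $\{0,\dots,L_i\}$; $\mathbb N_W$, $\mathbb B_Z$ denote integer states on $W$ and Boolean states on $Z$. $s_W$ denotes restriction, $-W$ the complement of $W$ in the whole variable set, states on disjoint variable sets are combined by union. Supports: pairwise disjoint sets $\mathrm{supp}(y)$ of Boolean variables, $\mathrm{supp}(W)=\bigcup_{y\in W}\mathrm{supp}(y)$. A decoding function $\psi$ is a partial map sending Boolean states on $\mathrm{supp}(W)$ to integer states on $W$ with $\psi(w_{\mathrm{supp}(W)})=\psi(w)_W$ for $w\in\mathrm{dom}\,\psi$. In a multi-valued network $\langle g,Y,M\rangle$, $s\xrightarrow{m}_g s'$ iff $s'_y=g_y(s)$ for $y\in m$ and $s'_y=s_y$ otherwise; the local network $\langle g_i,Y,\mathbf 1_{y_i}\rangle$ has the single mode component $\{y_i\}$. For a Boolean network $\langle f,X,M\rangle$ with $f:\mathbb B_X\to\mathbb B_X$, $f_m(w)$ is the restriction of $f(w)$ to $m$ and $w\xrightarrow{m}_f w'$ iff $w'=f_m(w)\cup w_{ -m}$. $B\sim_\psi N$ (for $B=\langle f,X,M_X\rangle$,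 $N=\langle g,Y,M_Y\rangle$) means there is a total $\mu:M_X\to M_Y$ such that (1) for $w,w'\in\mathrm{dom}\,\psi$ and $m\in M_X$, $w\xrightarrow{m}_f w'$ implies $\psi(w)\xrightarrow{\mu(m)}_g\psi(w')$; (2) for all $s,s'$, all $w$ with $\psi(w)=s$, all $n\in M_Y$, $s\xrightarrow{n}_g s'$ implies there exist $w'$, $m\in M_X$ with $\mu(m)=n$, $\psi(w')=s'$, $w\xrightarrow{m}_f w'$. Admissibility: $\mathrm{adm}_\psi(m,m_0)$ iff $\psi(f_{m_0}(w)\cup w_{ -m_0})=\psi(f_m(w)\cup w_{ -m})$ for all $w\in\mathbb B_{\mathrm{supp}(Y)}$; $\mathrm{adm}_\psi(M,M_0)$ iff every $m_0\in M_0$ has some $m\in M$ with $\mathrm{adm}_\psi(m,m_0)$ and every $m\in M$ has some $m_0\in M_0$ with $\mathrm{adm}_\psi(m,m_0)$. -}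

module Defs where

open import Data.Nat using (ℕ; suc)
open import Data.Fin using (Fin)
open import Data.Fin.Subset using (Subset; ⁅_⁆)
open import Data.Bool using (Bool; true; false; if_then_else_)
import Data.Bool.Properties as BoolP
open import Data.Vec using (Vec; lookup; tabulate)
open import Data.Vec.Properties using (≡-dec)
open import Data.Maybe using (Maybe; just; nothing)
open import Data.Product using (Σ; Σ-syntax; _×_; proj₁)
open import Data.Unit using (⊤)
open import Data.Empty using (⊥)
open import Relation.Nullary.Decidable using (⌊_⌋)
open import Relation.Binary.PropositionalEquality using (_≡_)

-- Integer variables Y = Fin n; variable y_i ranges over {0,…,L i}.
-- Integer state on Y:
IState : {n : ℕ} → (Fin n → ℕ) → Set
IState {n} L = (i : Fin n) → Fin (suc (L i))

-- Boolean variables supp(Y) = Fin k; 'owner x = i' means x ∈ supp(y_i).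
-- (Pairwise disjoint supports whose union is the Boolean variable set.)
BState : ℕ → Set
BState k = Vec Bool k

_≈ᵢ_ : {n : ℕ} {L : Fin n → ℕ} → IState L → IState L → Set
s ≈ᵢ t = ∀ i → s i ≡ t i

KEq : {n : ℕ} {L : Fin n → ℕ} → Maybe (IState L) → Maybe (IState L) → Set
KEq nothing nothing = ⊤
KEq (just s) (just t) = s ≈ᵢ t
KEq nothing (just _) = ⊥
KEq (just _) nothing = ⊥

-- Decoding function: ψ on full Boolean states (partial), together with its
-- restrictions ψ₁ i to states on supp(y_i) (a function of the full state that
-- depends only on the coordinates in supp(y_i)), and the compatibility
-- ψ(w_supp(y_i)) = ψ(w)_{y_i} for w ∈ dom ψ.
record Decoding {n k : ℕ} (L : Fin n → ℕ) (owner : Fin k → Fin n) : Set where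
  field
    ψ : BState k → Maybe (IState L)
    ψ₁ : (i : Fin n) → BState k → Maybe (Fin (suc (L i)))
    ψ₁-local : ∀ i (w v : BState k) →
      (∀ x → owner x ≡ i → lookup w x ≡ lookup v x) → ψ₁ i w ≡ ψ₁ i v
    compat : ∀ (w : BState k) (s : IState L) → ψ w ≡ just s →
      ∀ i → ψ₁ i w ≡ just (s i)

open Decoding public

Decodes : {n k : ℕ} {L : Fin n → ℕ} {owner : Fin k → Fin n} →
  Decoding L owner → BState k → IState L → Set
Decodes {L = L} D w s = Σ[ t ∈ IState L ] (ψ D w ≡ just t × t ≈ᵢ s)

update : {k : ℕ} → (BState k → BState k) → Subset k → BState k → BState k
update f m w = tabulate (λ x → if lookup m x then lookup (f w) x else lookup w x)

BStep : {k : ℕ} → (BState k → BState k) → Subset k → BState k → BState k → Set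
BStep f m w w' = w' ≡ update f m w

MStep : {n : ℕ} {L : Fin n → ℕ} → (IState L → IState L) → Subset n →
  IState L → IState L → Set
MStep g c s s' = ∀ j → s' j ≡ (if lookup c j then g s j else s j)

Mode : ℕ → Set
Mode k = Subset k → Bool

_∈ₘ_ : {k : ℕ} → Subset k → Mode k → Set
m ∈ₘ M = M m ≡ true

-- Mode of the local network ⟨g_i, Y, 1_{y_i}⟩: the single component {y_i}.
LocalMode : {n : ℕ} → Fin n → Mode n
LocalMode i c = ⌊ ≡-dec BoolP._≟_ c ⁅ i ⁆ ⌋

Sim : {n k : ℕ} {L : Fin n → ℕ} {owner : Fin k → Fin n} →
  Decoding L owner → (BState k → BState k) → Mode k →
  (IState L → IState L) → Mode n → Set
Sim {n} {k} {L} D f MX g MY =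
  Σ[ μ ∈ ((m : Subset k) → m ∈ₘ MX → Σ[ c ∈ Subset n ] c ∈ₘ MY) ]
    ((∀ (w w' : BState k) (s s' : IState L) → ψ D w ≡ just s → ψ D w' ≡ just s' →
        ∀ m (p : m ∈ₘ MX) → BStep f m w w' → MStep g (proj₁ (μ m p)) s s')
    × (∀ (s s' : IState L) (w : BState k) → ψ D w ≡ just s →
        ∀ c → c ∈ₘ MY → MStep g c s s' →
        Σ[ w' ∈ BState k ] Σ[ m ∈ Subset k ] Σ[ p ∈ m ∈ₘ MX ]
          (proj₁ (μ m p) ≡ c × Decodes D w' s' × BStep f m w w')))

adm : {n k : ℕ} {L : Fin n → ℕ} {owner : Fin k → Fin n} →
  Decoding L owner → (BState k → BState k) → Subset k → Subset k → Set
adm D f m m₀ = ∀ w → KEq (ψ D (update f m₀ w)) (ψ D (update f m w))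

Adm : {n k : ℕ} {L : Fin n → ℕ} {owner : Fin k → Fin n} →
  Decoding L owner → (BState k → BState k) → Mode k → Mode k → Set
Adm {k = k} D f M M₀ =
  (∀ m₀ → m₀ ∈ₘ M₀ → Σ[ m ∈ Subset k ] (m ∈ₘ M × adm D f m m₀))
  × (∀ m → m ∈ₘ M → Σ[ m₀ ∈ Subset k ] (m₀ ∈ₘ M₀ × adm D f m m₀))

-- With a single mode component {y_i} in the local network, the mode map μ is forced to be
-- constant. Admissibility says that an m-update and its partner m₀-update decode to the same
-- integer state, so every transition of ⟨f, supp(Y), M⟩ is decoded like a transition of
-- ⟨f, supp(Y), M₀⟩, and conversely; both directions of the simulation therefore carry over.
module Submission where

open import Defs
open import Data.Nat using (ℕ)
open import Data.Fin using (Fin)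
open import Data.Fin.Subset using (Subset; ⁅_⁆)
import Data.Bool.Properties as BoolP
open import Data.Maybe using (Maybe; just; nothing)
open import Data.Product using (Σ-syntax; _×_; _,_; proj₁; proj₂)
open import Function.Bundles using (Equivalence)
open import Relation.Nullary.Decidable using (toWitness; fromWitness)
open import Relation.Binary.PropositionalEquality using (_≡_; refl; sym; trans; subst)

module _ {n : ℕ} {L : Fin n → ℕ} where

  ≈ᵢ-sym : {s t : IState L} → s ≈ᵢ t → t ≈ᵢ s
  ≈ᵢ-sym e j = sym (e j)

  ≈ᵢ-trans : {s t u : IState L} → s ≈ᵢ t → t ≈ᵢ u → s ≈ᵢ u
  ≈ᵢ-trans e e' j = trans (e j) (e' j)

  KEq-sym : {x y : Maybe (IState L)} → KEq x y → KEq y x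
  KEq-sym {nothing} {nothing} _ = _
  KEq-sym {just _}  {just _}  e = ≈ᵢ-sym e

  KEq-transport : {x y : Maybe (IState L)} {s : IState L} → KEq x y →
    Σ[ t ∈ IState L ] (x ≡ just t × t ≈ᵢ s) →
    Σ[ u ∈ IState L ] (y ≡ just u × u ≈ᵢ s)
  KEq-transport {y = just u} e (t , refl , t≈s) = u , refl , ≈ᵢ-trans (≈ᵢ-sym e) t≈s

  MStep-resp-≈ᵢ : {g : IState L → IState L} {c : Subset n} {s s' t : IState L} →
    s' ≈ᵢ t → MStep g c s s' → MStep g c s t
  MStep-resp-≈ᵢ s'≈t step j = trans (sym (s'≈t j)) (step j)

LocalMode-unique : ∀ {n} (i : Fin n) {c : Subset n} → c ∈ₘ LocalMode i → c ≡ ⁅ i ⁆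
LocalMode-unique i p = toWitness (Equivalence.from BoolP.T-≡ p)

LocalMode-self : ∀ {n} (i : Fin n) → ⁅ i ⁆ ∈ₘ LocalMode i
LocalMode-self i = Equivalence.to BoolP.T-≡ (fromWitness refl)

module _ {n k : ℕ} {L : Fin n → ℕ} {owner : Fin k → Fin n}
         (D : Decoding L owner) (f : BState k → BState k) where

  adm-decodes : ∀ m m₀ → adm D f m m₀ → ∀ w {s} →
    Decodes D (update f m₀ w) s → Decodes D (update f m w) s
  adm-decodes _ _ a w = KEq-transport (a w)

  adm-decodes⁻¹ : ∀ m m₀ → adm D f m m₀ → ∀ w {s} →
    Decodes D (update f m w) s → Decodes D (update f m₀ w) s
  adm-decodes⁻¹ _ _ a w = KEq-transport (KEq-sym (a w))

module _ {n k : ℕ} {L : Fin n → ℕ} {owner : Fin k → Fin n}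
         (D : Decoding L owner) (f : BState k → BState k) (g : IState L → IState L) where

  ModeMap : Mode k → Mode n → Set
  ModeMap MX MY = (m : Subset k) → m ∈ₘ MX → Σ[ c ∈ Subset n ] c ∈ₘ MY

  Sound : (MX : Mode k) (MY : Mode n) → ModeMap MX MY → Set
  Sound MX MY μ = ∀ (w w' : BState k) (s s' : IState L) → ψ D w ≡ just s → ψ D w' ≡ just s' →
    ∀ m (p : m ∈ₘ MX) → BStep f m w w' → MStep g (proj₁ (μ m p)) s s'

  Complete : (MX : Mode k) (MY : Mode n) → ModeMap MX MY → Set
  Complete MX MY μ = ∀ (s s' : IState L) (w : BState k) → ψ D w ≡ just s →
    ∀ c → c ∈ₘ MY → MStep g c s s' →
    Σ[ w' ∈ BState k ] Σ[ m ∈ Subset k ] Σ[ p ∈ m ∈ₘ MX ]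
      (proj₁ (μ m p) ≡ c × Decodes D w' s' × BStep f m w w')

  module _ (i : Fin n) where

    toLocal : (MX : Mode k) → ModeMap MX (LocalMode i)
    toLocal _ _ _ = ⁅ i ⁆ , LocalMode-self i

    Sound-adm : ∀ {M₀ M} {μ₀ : ModeMap M₀ (LocalMode i)} → Sound M₀ (LocalMode i) μ₀ →
      (∀ m → m ∈ₘ M → Σ[ m₀ ∈ Subset k ] (m₀ ∈ₘ M₀ × adm D f m m₀)) →
      Sound M (LocalMode i) (toLocal M)
    Sound-adm {μ₀ = μ₀} sound₀ partner₀ w _ s s' ψw≡s ψw'≡s' m m∈M refl
      with partner₀ m m∈M
    ... | m₀ , m₀∈M₀ , a
      with adm-decodes⁻¹ D f m m₀ a w (s' , ψw'≡s' , λ _ → refl)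
    ... | t , ψ≡t , t≈s' =
      subst (λ c → MStep g c s s') (LocalMode-unique i (proj₂ (μ₀ m₀ m₀∈M₀)))
        (MStep-resp-≈ᵢ {g = g} {c = proj₁ (μ₀ m₀ m₀∈M₀)} t≈s'
          (sound₀ w (update f m₀ w) s t ψw≡s ψ≡t m₀ m₀∈M₀ refl))

    Complete-adm : ∀ {M₀ M} {μ₀ : ModeMap M₀ (LocalMode i)} → Complete M₀ (LocalMode i) μ₀ →
      (∀ m₀ → m₀ ∈ₘ M₀ → Σ[ m ∈ Subset k ] (m ∈ₘ M × adm D f m m₀)) →
      Complete M (LocalMode i) (toLocal M)
    Complete-adm complete₀ partner s s' w ψw≡s c c∈N step
      with complete₀ s s' w ψw≡s c c∈N step
    ... | _ , m₀ , m₀∈M₀ , _ , decodes , refl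
      with partner m₀ m₀∈M₀
    ... | m , m∈M , a =
      update f m w , m , m∈M , sym (LocalMode-unique i c∈N) ,
      adm-decodes D f m m₀ a w decodes , refl

theorem2 : ∀ {n k : ℕ} (L : Fin n → ℕ) (owner : Fin k → Fin n)
    (D : Decoding L owner) (f : BState k → BState k) (M₀ : Mode k)
    (i : Fin n) (g : IState L → IState L) →
    Sim D f M₀ g (LocalMode i) →
    (M : Mode k) → Adm D f M M₀ →
    Sim D f M g (LocalMode i)
theorem2 L owner D f M₀ i g (μ₀ , sound₀ , complete₀) M (partner , partner₀) =
  toLocal D f g i M ,
  Sound-adm D f g i {μ₀ = μ₀} sound₀ partner₀ ,
  Complete-adm D f g i {μ₀ = μ₀} complete₀ partner
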